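{- Let $M$ and $L$ be matroids on a finite set $E$ with $\rho(L)=\rho(M)+s$, where $s\in\mathbb{N}$. Suppose that every circuit of $L$ is the union of some circuits of $M$. If $A$ is a cyclic set of $M$ with $c(A)=s+1$, then $A$ is not an independent set of $L$.
   Context: $\rho(\cdot)$ denotes the rank of a matroid. A cyclic set of $M$ is a subset of $E$ that is a union of some circuits of $M$. For $A\subseteq E$, $c(A)=|A\setminus I|$ where $I$ is a maximal independent subset of $A$ in $M$. -}

module Defs where

open import Data.Nat using (ℕ; _≤_; _<_)
open import Data.Fin.Subset using (Subset; ⊥; ⊤; _⊆_; _⊂_; _─_; ⋃; ∣_∣)
open import Data.List using (List)
open import Data.List.Relation.Unary.All using (All)
open import Data.Product using (Σ; ∃; _×_)
open import Relation.Binary.PropositionalEquality using (_≡_)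
open import Relation.Nullary using (¬_)

record Matroid (n : ℕ) : Set₁ where
  field
    Indep      : Subset n → Set
    indep-⊥    : Indep ⊥
    indep-⊆    : ∀ {X Y} → Y ⊆ X → Indep X → Indep Y
    augment    : ∀ {X Y} → Indep X → Indep Y → ∣ X ∣ < ∣ Y ∣ →
                 ∃ λ y → (y Data.Fin.Subset.∈ Y) × (¬ (y Data.Fin.Subset.∈ X)) ×
                   Indep (X Data.Fin.Subset.∪ (Data.Fin.Subset.⁅ y ⁆))

open Matroid public

module _ {n : ℕ} (M : Matroid n) where

  Circuit : Subset n → Set
  Circuit C = ¬ Indep M C × (∀ D → D ⊂ C → Indep M D)

  Cyclic : Subset n → Set
  Cyclic A = Σ (List (Subset n)) λ Cs → All Circuit Cs × A ≡ ⋃ Cs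

  MaxIndepIn : Subset n → Subset n → Set
  MaxIndepIn A I = I ⊆ A × Indep M I × (∀ J → I ⊂ J → J ⊆ A → ¬ Indep M J)

  IsRankOf : Subset n → ℕ → Set
  IsRankOf X r = (∃ λ I → I ⊆ X × Indep M I × ∣ I ∣ ≡ r)
               × (∀ I → I ⊆ X → Indep M I → ∣ I ∣ ≤ r)

  IsRank : ℕ → Set
  IsRank r = IsRankOf ⊤ r

  -- c(A) = k : k = |A ∖ I| for a maximal independent subset I of A
  -- (well defined since all such I have size ρ(A)).
  Nullity≡ : Subset n → ℕ → Set
  Nullity≡ A k = ∃ λ I → MaxIndepIn A I × ∣ A ─ I ∣ ≡ k

{-# OPTIONS --safe #-}
-- Let X be L-independent and K a maximal M-independent subset of X. Enlarge K, one element y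
-- of an M-basis at a time, to an M-basis J while keeping X ∪ J independent in L: an L-circuit
-- through y is a union of M-circuits, so one of them passes through y inside X ∪ J ∪ {y}, which
-- puts y in the M-closure of X ∪ J = the M-closure of J, contradicting the M-independence of
-- J ∪ {y}. Hence c(X) + ρ(M) = |X ∖ K| + |J| ≤ |X ∪ J| ≤ ρ(L), i.e. c(X) ≤ s, for every
-- L-independent X. Independence is not decidable, so dependent
-- sets only contain circuits under double negation, which suffices for these negative goals.
module Submission where

open import Defs
open import Data.Nat using (ℕ; zero; suc; _+_; _≤_; _<_; s≤s; _≤?_)
open import Data.Nat.Properties
  using (module ≤-Reasoning; ≤-refl; ≤-trans; ≤-reflexive; <-irrefl; ≰⇒>; +-suc; +-comm; m≤m+n;
         +-monoʳ-≤; +-monoˡ-≤; +-monoʳ-<)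
open import Data.Fin using (Fin; zero; suc; _≟_)
open import Data.Fin.Properties using (any?)
open import Data.Fin.Subset
  using (Subset; ⋃; _∈_; _∉_; _⊆_; _⊂_; _∪_; _─_; _-_; ⁅_⁆; ∣_∣; inside; outside)
open import Data.Fin.Subset.Properties
  using (_∈?_; drop-there; ⊆-refl; ⊆-trans; ∉⊥; x∈⁅x⁆; x∈⁅y⁆⇒x≡y; x∈p∪q⁻; p⊆p∪q; q⊆p∪q; p─q⊆p; x∈p∧x∉q⇒x∈p─q;
         x∈p∧x≢y⇒x∈p-y; x∈p⇒p-x⊂p; x∈p⇒∣p-x∣<∣p∣; p⊆q⇒∣p∣≤∣q∣; p⊂q⇒∣p∣<∣q∣; ⊆⊤)
open import Data.Vec using ([]; _∷_; here; there)
open import Data.List using (List; []; _∷_)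
open import Data.List.Relation.Unary.All using (All; []; _∷_)
open import Data.Product using (Σ; ∃; _×_; _,_; proj₂)
open import Data.Sum using (_⊎_; inj₁; inj₂)
open import Data.Empty using (⊥)
open import Function using (_∘_)
open import Relation.Binary.PropositionalEquality using (_≡_; refl; sym; trans; cong; cong₂)
open import Relation.Nullary using (¬_; Dec; yes; no; contradiction; ¬?; _×-dec_)
open import Relation.Nullary.Decidable using (decidable-stable; ¬¬-excluded-middle)
open import Relation.Nullary.Negation using (¬¬-map)

x∈p─q⇒x∉q : ∀ {n} {x : Fin n} (p q : Subset n) → x ∈ p ─ q → x ∉ q
x∈p─q⇒x∉q (inside  ∷ p) (outside ∷ q) here       = λ ()
x∈p─q⇒x∉q {x = zero} (inside  ∷ p) (inside  ∷ q) ()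
x∈p─q⇒x∉q {x = zero} (outside ∷ p) (inside  ∷ q) ()
x∈p─q⇒x∉q {x = zero} (outside ∷ p) (outside ∷ q) ()
x∈p─q⇒x∉q (_       ∷ p) (_       ∷ q) (there x∈) = x∈p─q⇒x∉q p q x∈ ∘ drop-there

x∈p∪⁅y⁆⇒x∈p⊎x≡y : ∀ {n} {x : Fin n} (p : Subset n) y → x ∈ p ∪ ⁅ y ⁆ → x ∈ p ⊎ x ≡ y
x∈p∪⁅y⁆⇒x∈p⊎x≡y p y x∈ with x∈p∪q⁻ p ⁅ y ⁆ x∈
... | inj₁ x∈p = inj₁ x∈p
... | inj₂ x∈y = inj₂ (x∈⁅y⁆⇒x≡y y x∈y)

x∉p⇒p⊂p∪⁅x⁆ : ∀ {n} {x : Fin n} {p : Subset n} → x ∉ p → p ⊂ p ∪ ⁅ x ⁆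
x∉p⇒p⊂p∪⁅x⁆ {x = x} {p} x∉p = p⊆p∪q ⁅ x ⁆ , x , q⊆p∪q p ⁅ x ⁆ (x∈⁅x⁆ x) , x∉p

∪-lub : ∀ {n} {p q r : Subset n} → p ⊆ r → q ⊆ r → p ∪ q ⊆ r
∪-lub {p = p} {q} p⊆r q⊆r x∈ with x∈p∪q⁻ p q x∈
... | inj₁ x∈p = p⊆r x∈p
... | inj₂ x∈q = q⊆r x∈q

x∈p⇒⁅x⁆⊆p : ∀ {n} {x : Fin n} {p : Subset n} → x ∈ p → ⁅ x ⁆ ⊆ p
x∈p⇒⁅x⁆⊆p {x = x} x∈p y∈⁅x⁆ rewrite x∈⁅y⁆⇒x≡y x y∈⁅x⁆ = x∈p

p⊆q∪⁅x⁆∧x∉p⇒p⊆q : ∀ {n} {x : Fin n} {p q : Subset n} → p ⊆ q ∪ ⁅ x ⁆ → x ∉ p → p ⊆ q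
p⊆q∪⁅x⁆∧x∉p⇒p⊆q {x = x} {q = q} p⊆ x∉p y∈p with x∈p∪⁅y⁆⇒x∈p⊎x≡y q x (p⊆ y∈p)
... | inj₁ y∈q = y∈q
... | inj₂ refl = contradiction y∈p x∉p

p⊆p-x∪⁅x⁆ : ∀ {n} (p : Subset n) x → p ⊆ (p - x) ∪ ⁅ x ⁆
p⊆p-x∪⁅x⁆ p x {y} y∈p with y ≟ x
... | yes refl = q⊆p∪q (p - x) ⁅ x ⁆ (x∈⁅x⁆ x)
... | no y≢x   = p⊆p∪q ⁅ x ⁆ (x∈p∧x≢y⇒x∈p-y y∈p y≢x)

∣p─q∣+∣q∣≡∣p∣ : ∀ {n} {p q : Subset n} → q ⊆ p → ∣ p ─ q ∣ + ∣ q ∣ ≡ ∣ p ∣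
∣p─q∣+∣q∣≡∣p∣ {p = []}          {[]}          _   = refl
∣p─q∣+∣q∣≡∣p∣ {p = inside ∷ p}  {inside ∷ q}  q⊆p =
  trans (+-suc ∣ p ─ q ∣ ∣ q ∣) (cong suc (∣p─q∣+∣q∣≡∣p∣ (drop-there ∘ q⊆p ∘ there)))
∣p─q∣+∣q∣≡∣p∣ {p = inside ∷ p}  {outside ∷ q} q⊆p = cong suc (∣p─q∣+∣q∣≡∣p∣ (drop-there ∘ q⊆p ∘ there))
∣p─q∣+∣q∣≡∣p∣ {p = outside ∷ p} {inside ∷ q}  q⊆p = contradiction (q⊆p here) λ ()
∣p─q∣+∣q∣≡∣p∣ {p = outside ∷ p} {outside ∷ q} q⊆p = ∣p─q∣+∣q∣≡∣p∣ (drop-there ∘ q⊆p ∘ there)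

x∈⋃⁻ : ∀ {n} {x : Fin n} {P : Subset n → Set} (Ds : List (Subset n)) → All P Ds → x ∈ ⋃ Ds →
       ∃ λ D → P D × x ∈ D × D ⊆ ⋃ Ds
x∈⋃⁻ []       []         x∈ = contradiction x∈ ∉⊥
x∈⋃⁻ (D ∷ Ds) (PD ∷ PDs) x∈ with x∈p∪q⁻ D (⋃ Ds) x∈
... | inj₁ x∈D = D , PD , x∈D , p⊆p∪q (⋃ Ds)
... | inj₂ x∈⋃ with x∈⋃⁻ Ds PDs x∈⋃
...   | D′ , PD′ , x∈D′ , D′⊆ = D′ , PD′ , x∈D′ , ⊆-trans D′⊆ (q⊆p∪q D (⋃ Ds))

¬¬-∀-Fin : ∀ {n} {P : Fin n → Set} → (∀ i → ¬ ¬ P i) → ¬ ¬ (∀ i → P i)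
¬¬-∀-Fin {zero}  _   k = k λ ()
¬¬-∀-Fin {suc n} ¬¬P k = ¬¬P zero λ P0 → ¬¬-∀-Fin (¬¬P ∘ suc) λ P+ → k λ where
  zero    → P0
  (suc i) → P+ i

module _ {n : ℕ} (N : Matroid n) where

  dependent⇒circuit⊎dependent-deletion : ∀ {X} → ¬ Indep N X →
    ¬ ¬ (Circuit N X ⊎ ∃ λ x → x ∈ X × ¬ Indep N (X - x))
  dependent⇒circuit⊎dependent-deletion {X} dep = ¬¬-map classify (¬¬-∀-Fin λ _ → ¬¬-excluded-middle)
    where
    classify : (∀ x → Dec (Indep N (X - x))) → Circuit N X ⊎ ∃ λ x → x ∈ X × ¬ Indep N (X - x)
    classify deletion? with any? (λ x → x ∈? X ×-dec ¬? (deletion? x))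
    ... | yes found = inj₂ found
    ... | no none   = inj₁ (dep , λ D → proper-indep)
      where
      proper-indep : ∀ {D} → D ⊂ X → Indep N D
      proper-indep (D⊆X , x , x∈X , x∉D) =
        indep-⊆ N (λ y∈D → x∈p∧x≢y⇒x∈p-y (D⊆X y∈D) λ { refl → x∉D y∈D })
          (decidable-stable (deletion? x) λ dep′ → none (x , x∈X , dep′))

  dependent⇒circuit : ∀ k {X} → ∣ X ∣ < k → ¬ Indep N X → ¬ ¬ ∃ λ C → C ⊆ X × Circuit N C
  dependent⇒circuit (suc k) {X} (s≤s ∣X∣≤k) dep no-circuit =
    dependent⇒circuit⊎dependent-deletion dep λ where
      (inj₁ X-circuit)         → no-circuit (X , ⊆-refl , X-circuit)
      (inj₂ (x , x∈X , dep′)) →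
        dependent⇒circuit k (≤-trans (x∈p⇒∣p-x∣<∣p∣ x∈X) ∣X∣≤k) dep′ λ (C , C⊆X-x , C-circuit) →
          no-circuit (C , ⊆-trans C⊆X-x (p─q⊆p X ⁅ x ⁆) , C-circuit)

  maxIndepIn⇒dependent-extension : ∀ {X K x} → MaxIndepIn N X K → x ∈ X → x ∉ K → ¬ Indep N (K ∪ ⁅ x ⁆)
  maxIndepIn⇒dependent-extension (K⊆X , _ , maximal) x∈X x∉K =
    maximal _ (x∉p⇒p⊂p∪⁅x⁆ x∉K) (∪-lub K⊆X (x∈p⇒⁅x⁆⊆p x∈X))

  maxIndepIn⇒isRankOf : ∀ {X K} → MaxIndepIn N X K → IsRankOf N X ∣ K ∣
  maxIndepIn⇒isRankOf {X} {K} maxK@(K⊆X , iK , _) = (K , K⊆X , iK , refl) , bounded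
    where
    bounded : ∀ I → I ⊆ X → Indep N I → ∣ I ∣ ≤ ∣ K ∣
    bounded I I⊆X iI with ∣ I ∣ ≤? ∣ K ∣
    ... | yes I≤K = I≤K
    ... | no I≰K with augment N iK iI (≰⇒> I≰K)
    ...   | x , x∈I , x∉K , iKx = contradiction iKx (maxIndepIn⇒dependent-extension maxK (I⊆X x∈I) x∉K)

  maxIndepIn-∪⁅⁆ : ∀ {X K y} → MaxIndepIn N X K → y ∉ K → Indep N (K ∪ ⁅ y ⁆) →
                   MaxIndepIn N (X ∪ ⁅ y ⁆) (K ∪ ⁅ y ⁆)
  maxIndepIn-∪⁅⁆ {X} {K} {y} maxK@(K⊆X , _ , _) y∉K iKy = Ky⊆Xy , iKy , maximal
    where
    Ky⊆Xy : K ∪ ⁅ y ⁆ ⊆ X ∪ ⁅ y ⁆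
    Ky⊆Xy = ∪-lub (⊆-trans K⊆X (p⊆p∪q ⁅ y ⁆)) (q⊆p∪q X ⁅ y ⁆)
    maximal : ∀ J → K ∪ ⁅ y ⁆ ⊂ J → J ⊆ X ∪ ⁅ y ⁆ → ¬ Indep N J
    maximal J (Ky⊆J , z , z∈J , z∉Ky) J⊆Xy iJ with x∈p∪⁅y⁆⇒x∈p⊎x≡y X y (J⊆Xy z∈J)
    ... | inj₂ refl = z∉Ky (q⊆p∪q K ⁅ y ⁆ (x∈⁅x⁆ y))
    ... | inj₁ z∈X  = maxIndepIn⇒dependent-extension maxK z∈X (z∉Ky ∘ p⊆p∪q ⁅ y ⁆)
                        (indep-⊆ N (∪-lub (⊆-trans (p⊆p∪q ⁅ y ⁆) Ky⊆J) (x∈p⇒⁅x⁆⊆p z∈J)) iJ)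

  augment-until : ∀ k {P Q} → Indep N P → Indep N Q → ∣ Q ∣ ≤ k + ∣ P ∣ →
                  ∃ λ W → Indep N W × P ⊆ W × W ⊆ P ∪ Q × ∣ Q ∣ ≤ ∣ W ∣
  augment-until k {P} {Q} iP iQ fuel with ∣ Q ∣ ≤? ∣ P ∣
  ... | yes Q≤P = P , iP , ⊆-refl , p⊆p∪q Q , Q≤P
  augment-until zero    iP iQ fuel | no Q≰P = contradiction fuel Q≰P
  augment-until (suc k) {P} {Q} iP iQ fuel | no Q≰P with augment N iP iQ (≰⇒> Q≰P)
  ... | y , y∈Q , y∉P , iPy
    with augment-until k iPy iQ (≤-trans fuel (+-monoʳ-< k (p⊂q⇒∣p∣<∣q∣ (x∉p⇒p⊂p∪⁅x⁆ y∉P))))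
  ...   | W , iW , Py⊆W , W⊆PyQ , Q≤W =
    W , iW , ⊆-trans (p⊆p∪q ⁅ y ⁆) Py⊆W ,
    ⊆-trans W⊆PyQ (∪-lub (∪-lub (p⊆p∪q Q) (x∈p⇒⁅x⁆⊆p (q⊆p∪q P Q y∈Q))) (q⊆p∪q P Q)) , Q≤W

  -- Augment D − e from K ∪ {e}: the result either contains e, hence D, or lies in Y and
  -- exceeds the rank |K| of Y.
  maxIndepIn-spans-circuit : ∀ {Y K D e} → MaxIndepIn N Y K → e ∉ K →
                             Circuit N D → e ∈ D → D ⊆ Y ∪ ⁅ e ⁆ → ¬ Indep N (K ∪ ⁅ e ⁆)
  maxIndepIn-spans-circuit {Y} {K} {D} {e} maxK@(K⊆Y , _ , _) e∉K (D-dep , D-minimal) e∈D D⊆Ye iKe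
    with augment-until ∣ K ∪ ⁅ e ⁆ ∣ (D-minimal (D - e) (x∈p⇒p-x⊂p e∈D)) iKe (m≤m+n _ _)
  ... | W , iW , D-e⊆W , W⊆ , Ke≤W with e ∈? W
  ... | yes e∈W = D-dep (indep-⊆ N (⊆-trans (p⊆p-x∪⁅x⁆ D e) (∪-lub D-e⊆W (x∈p⇒⁅x⁆⊆p e∈W))) iW)
  ... | no  e∉W = <-irrefl refl (begin-strict
      ∣ K ∣           <⟨ p⊂q⇒∣p∣<∣q∣ (x∉p⇒p⊂p∪⁅x⁆ e∉K) ⟩
      ∣ K ∪ ⁅ e ⁆ ∣   ≤⟨ Ke≤W ⟩
      ∣ W ∣           ≤⟨ proj₂ (maxIndepIn⇒isRankOf maxK) W W⊆Y iW ⟩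
      ∣ K ∣           ∎)
    where
    open ≤-Reasoning
    Ke⊆Ye : K ∪ ⁅ e ⁆ ⊆ Y ∪ ⁅ e ⁆
    Ke⊆Ye = ∪-lub (⊆-trans K⊆Y (p⊆p∪q ⁅ e ⁆)) (q⊆p∪q Y ⁅ e ⁆)
    W⊆Y : W ⊆ Y
    W⊆Y = p⊆q∪⁅x⁆∧x∉p⇒p⊆q (⊆-trans W⊆ (∪-lub (⊆-trans (p─q⊆p D ⁅ e ⁆) D⊆Ye) Ke⊆Ye)) e∉W

module _ {n : ℕ} (M L : Matroid n) (L-circuit⇒M-cyclic : ∀ C → Circuit L C → Cyclic M C) where

  L-indep-∪⁅⁆ : ∀ {X K y} → Indep L X → MaxIndepIn M X K → y ∉ K → Indep M (K ∪ ⁅ y ⁆) →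
                ¬ ¬ Indep L (X ∪ ⁅ y ⁆)
  L-indep-∪⁅⁆ {X} {K} {y} iX maxK y∉K iKy Xy-dep =
    dependent⇒circuit L _ ≤-refl Xy-dep λ (C , C⊆Xy , C-circuit) → no-circuit C C⊆Xy C-circuit
    where
    no-circuit : ∀ C → C ⊆ X ∪ ⁅ y ⁆ → Circuit L C → ⊥
    no-circuit C C⊆Xy C-circuit@(C-dep , _) with y ∈? C | L-circuit⇒M-cyclic C C-circuit
    ... | no y∉C  | _ = C-dep (indep-⊆ L (p⊆q∪⁅x⁆∧x∉p⇒p⊆q C⊆Xy y∉C) iX)
    ... | yes y∈C | Ds , Ds-circuits , refl with x∈⋃⁻ Ds Ds-circuits y∈C
    ...   | D , D-circuit , y∈D , D⊆C =
      maxIndepIn-spans-circuit M maxK y∉K D-circuit y∈D (⊆-trans D⊆C C⊆Xy) iKy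

  large-L-indep : ∀ k {B X K} → Indep M B → ∣ B ∣ ≤ k + ∣ K ∣ → Indep L X → MaxIndepIn M X K →
                  ¬ ¬ ∃ λ X′ → Indep L X′ × ∣ X ─ K ∣ + ∣ B ∣ ≤ ∣ X′ ∣
  large-L-indep k {B} {X} {K} iB fuel iX (K⊆X , _ , _) no-X′ with ∣ B ∣ ≤? ∣ K ∣
  ... | yes B≤K = no-X′ (X , iX , (begin
      ∣ X ─ K ∣ + ∣ B ∣  ≤⟨ +-monoʳ-≤ ∣ X ─ K ∣ B≤K ⟩
      ∣ X ─ K ∣ + ∣ K ∣  ≡⟨ ∣p─q∣+∣q∣≡∣p∣ K⊆X ⟩
      ∣ X ∣              ∎))
    where open ≤-Reasoning
  large-L-indep zero    iB fuel iX maxK no-X′ | no B≰K = contradiction fuel B≰K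
  large-L-indep (suc k) {B} {X} {K} iB fuel iX maxK@(_ , iK , _) no-X′ | no B≰K
    with augment M iK iB (≰⇒> B≰K)
  ... | y , _ , y∉K , iKy =
    L-indep-∪⁅⁆ iX maxK y∉K iKy λ iXy →
    large-L-indep k iB fuel′ iXy (maxIndepIn-∪⁅⁆ M maxK y∉K iKy) λ (X′ , iX′ , X′-large) →
    no-X′ (X′ , iX′ , ≤-trans (+-monoˡ-≤ ∣ B ∣ (p⊆q⇒∣p∣≤∣q∣ X─K⊆Xy─Ky)) X′-large)
    where
    fuel′ : ∣ B ∣ ≤ k + ∣ K ∪ ⁅ y ⁆ ∣
    fuel′ = ≤-trans fuel (+-monoʳ-< k (p⊂q⇒∣p∣<∣q∣ (x∉p⇒p⊂p∪⁅x⁆ y∉K)))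
    X─K⊆Xy─Ky : X ─ K ⊆ (X ∪ ⁅ y ⁆) ─ (K ∪ ⁅ y ⁆)
    X─K⊆Xy─Ky {x} x∈X─K = x∈p∧x∉q⇒x∈p─q (p⊆p∪q ⁅ y ⁆ x∈X) x∉Ky
      where
      x∈X : x ∈ X
      x∈X = p─q⊆p X K x∈X─K
      x∉Ky : x ∉ K ∪ ⁅ y ⁆
      x∉Ky x∈Ky with x∈p∪⁅y⁆⇒x∈p⊎x≡y K y x∈Ky
      ... | inj₁ x∈K = x∈p─q⇒x∉q X K x∈X─K x∈K
      ... | inj₂ refl = maxIndepIn⇒dependent-extension M maxK x∈X y∉K iKy

  nullity+rank≤rank : ∀ {rM rL X c} → IsRank M rM → IsRank L rL → Indep L X → Nullity≡ M X c →
                      c + rM ≤ rL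
  nullity+rank≤rank {rM} {rL} {X} {c}
    ((B , _ , iB , ∣B∣≡rM) , _) (_ , L-bounded) iX (K , maxK , ∣X─K∣≡c) =
    decidable-stable (c + rM ≤? rL) λ c+rM≰rL →
      large-L-indep rM iB (≤-trans (≤-reflexive ∣B∣≡rM) (m≤m+n rM ∣ K ∣)) iX maxK
        λ (X′ , iX′ , X′-large) →
        c+rM≰rL (begin
          c + rM             ≡⟨ cong₂ _+_ (sym ∣X─K∣≡c) (sym ∣B∣≡rM) ⟩
          ∣ X ─ K ∣ + ∣ B ∣  ≤⟨ X′-large ⟩
          ∣ X′ ∣             ≤⟨ L-bounded X′ ⊆⊤ iX′ ⟩
          rL                 ∎)
    where open ≤-Reasoning

lemma4 : ∀ {n : ℕ} (M L : Matroid n) (s rM rL : ℕ) →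
    IsRank M rM → IsRank L rL → rL ≡ rM + s →
    (∀ C → Circuit L C → Σ (List (Subset n)) λ Cs → All (Circuit M) Cs × C ≡ ⋃ Cs) →
    ∀ (A : Subset n) → Cyclic M A → Nullity≡ M A (suc s) →
    ¬ Indep L A
lemma4 M L s rM rL rankM rankL rL≡rM+s L-circuit⇒M-cyclic A _ nullity iA =
  <-irrefl refl (begin-strict
    s + rM  <⟨ nullity+rank≤rank M L L-circuit⇒M-cyclic rankM rankL iA nullity ⟩
    rL      ≡⟨ rL≡rM+s ⟩
    rM + s  ≡⟨ +-comm rM s ⟩
    s + rM  ∎)
  where open ≤-Reasoning
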